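{- For every integer $k \geq 2$, every finite digraph $G$ is $2/k$-majority $k$-choosable. That is, for every assignment $L: V(G) \to \mathcal{P}(\mathbb{N})$ of lists with $|L(v)| \geq k$ for all $v \in V(G)$, there is a colouring $C: V(G) \to \mathbb{N}$ with $C(v) \in L(v)$ for every $v \in V(G)$ such that for every $v \in V(G)$, at most $\frac{2}{k} d^+(v)$ out-neighbours of $v$ have colour $C(v)$.
   Context: For a vertex $v$ of a digraph $G$, $d^+(v)$ denotes its out-degree and out-neighbours are vertices $w$ with an edge $vw$ from $v$ to $w$. Colourings need not be proper. For $\eta \in [0,1]$, a colouring $C$ of $V(G)$ is an $\eta$-majority colouring if for every $v$, at most $\eta d^+(v)$ out-neighbours of $v$ have colour $C(v)$. Given lists $L: V(G) \to \mathcal{P}(\mathbb{N})$, an $L$-colouring is a colouring $C: V(G)\to\mathbb{N}$ with $C(v) \in L(v)$ for all $v$; $G$ is $\eta$-majority $k$-choosable if it has an $\eta$-majority $L$-colouring for every list assignment $L$ with all lists of size at least $k$. -}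

module Defs where

open import Data.Nat using (ℕ; _≤_; _*_; _≟_)
open import Data.Fin using (Fin)
open import Data.Bool using (Bool; true; false)
import Data.Bool as B
open import Data.List using (List; length; filter; allFin)
open import Data.List.Relation.Unary.All using (All)
open import Data.List.Relation.Unary.Unique.Propositional using (Unique)
open import Data.Product using (Σ; _×_)
open import Relation.Binary.PropositionalEquality using (_≡_)
open import Relation.Nullary using (¬_)

record Digraph : Set where
  field
    n    : ℕ
    E    : Fin n → Fin n → Bool
    loopless : ∀ v → E v v ≡ false

open Digraph public

outNbrs : (G : Digraph) → Fin (n G) → List (Fin (n G))
outNbrs G v = filter (λ w → E G v w B.≟ true) (allFin (n G))

outdeg : (G : Digraph) → Fin (n G) → ℕ
outdeg G v = length (outNbrs G v)

sameColOut : (G : Digraph) → (Fin (n G) → ℕ) → Fin (n G) → ℕ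
sameColOut G C v = length (filter (λ w → C w ≟ C v) (outNbrs G v))

ListAssignment : Digraph → Set₁
ListAssignment G = Fin (n G) → ℕ → Set

AtLeast : ℕ → (ℕ → Set) → Set
AtLeast k S = Σ (List ℕ) λ xs → length xs ≡ k × Unique xs × All S xs

IsLColouring : (G : Digraph) → ListAssignment G → (Fin (n G) → ℕ) → Set
IsLColouring G L C = ∀ v → L v (C v)

-- (p/q)-majority colouring: for every v, at most (p/q)·d⁺(v) out-neighbours
-- of v have colour C v, i.e. q · #same ≤ p · d⁺(v)   (q > 0)
IsMajority : (p q : ℕ) → (G : Digraph) → (Fin (n G) → ℕ) → Set
IsMajority p q G C = ∀ v → q * sameColOut G C v ≤ p * outdeg G v

MajorityChoosable : (p q k : ℕ) → Digraph → Set₁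
MajorityChoosable p q k G =
  (L : ListAssignment G) → (∀ v → AtLeast k (L v)) →
  Σ (Fin (n G) → ℕ) λ C → IsLColouring G L C × IsMajority p q G C

-- Choose weights α(v) > 0 with  ∑_{u→v} α(u) < (d⁺(v) + 1)·α(v)  for every v; they exist
-- because the matrix diag(d⁺ + 1) − Aᵀ is strictly diagonally dominant (Gaussian elimination
-- over ℕ).  Consider the potential  Φ(C) = ∑_u α(u)·#{out-neighbours of u coloured C(u)}.
-- Recolouring v with x changes Φ by cost(x) − cost(C(v)), where cost(x) counts the
-- out-neighbours of v coloured x with weight α(v) and the in-neighbours coloured x with their
-- own weight.  Over k distinct colours these costs sum to at most
-- α(v)·d⁺(v) + ∑_{u→v} α(u) < α(v)·(2d⁺(v) + 1), whereas if more than 2d⁺(v)/k out-neighbours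
-- of v share its colour then k·cost(C(v)) ≥ α(v)·(2d⁺(v) + 1).  So the cheapest colour of L(v)
-- is strictly cheaper, Φ drops, and repeating this terminates in a 2/k-majority colouring.

module Submission where

open import Data.Bool using (true; false; if_then_else_)
import Data.Bool as Bool
open import Data.Fin using (Fin; zero; suc)
import Data.Fin.Properties as Fin
open import Data.List using ([]; _∷_; length; lookup; filter; tabulate)
open import Data.List.Membership.Propositional.Properties using (∈-lookup)
open import Data.List.Relation.Unary.All as All using (All; []; _∷_)
open import Data.List.Relation.Unary.AllPairs using ([]; _∷_)
open import Data.List.Relation.Unary.Unique.Propositional using (Unique)
open import Data.Nat
open import Data.Nat.Induction using (<-wellFounded)
open import Data.Nat.Properties
open import Algebra.Properties.Semiring.Sum +-*-semiring
  using (sum; sum-syntax; sum-cong-≗; sum-replicate-zero; ∑-distrib-+; ∑-comm;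
         *-distribˡ-sum; *-distribʳ-sum)
open import Data.Nat.Tactic.RingSolver using (solve-∀)
open import Data.Product using (Σ; ∃; _×_; _,_; proj₁; proj₂)
open import Data.Vec.Functional using (updateAt)
open import Data.Vec.Functional.Properties using (updateAt-updates; updateAt-minimal; updateAt-id-local)
open import Defs
open import Function using (_∘_; const; id)
open import Induction.WellFounded using (Acc; acc)
open import Relation.Binary.PropositionalEquality
open import Relation.Nullary using (Dec; does; yes; no; ¬_; ¬?; contradiction)
open import Relation.Nullary.Decidable using (dec-true; dec-false)
open import Relation.Unary using (Pred; Decidable)

-- Defined through does, so that e.g. 𝟙 (¬? (yes p)) reduces.
𝟙 : ∀ {p} {P : Set p} → Dec P → ℕ
𝟙 P? = if does P? then 1 else 0

𝟙-yes : ∀ {p} {P : Set p} (P? : Dec P) → P → 𝟙 P? ≡ 1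
𝟙-yes P? p rewrite dec-true P? p = refl

𝟙-no : ∀ {p} {P : Set p} (P? : Dec P) → ¬ P → 𝟙 P? ≡ 0
𝟙-no P? ¬p rewrite dec-false P? ¬p = refl

𝟙-≟-sym : (x y : ℕ) → 𝟙 (x ≟ y) ≡ 𝟙 (y ≟ x)
𝟙-≟-sym x y with x ≟ y
... | yes x≡y = trans (𝟙-yes (x ≟ y) x≡y) (sym (𝟙-yes (y ≟ x) (sym x≡y)))
... | no  x≢y = trans (𝟙-no (x ≟ y) x≢y) (sym (𝟙-no (y ≟ x) (x≢y ∘ sym)))

∑-scale : ∀ {n} x (f : Fin n → ℕ) → ∑[ i < n ] (x * f i) ≡ x * sum f
∑-scale x f = sym (*-distribˡ-sum x f)

∑∑-distrib-+ : ∀ {m n} (f g : Fin m → Fin n → ℕ) →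
               ∑[ i < m ] ∑[ j < n ] (f i j + g i j) ≡ ∑[ i < m ] ∑[ j < n ] f i j + ∑[ i < m ] ∑[ j < n ] g i j
∑∑-distrib-+ {m} {n} f g =
  trans (sum-cong-≗ (λ i → ∑-distrib-+ (f i) (g i))) (∑-distrib-+ (λ i → ∑[ j < n ] f i j) (λ i → ∑[ j < n ] g i j))

∑-mono-≤ : ∀ {n} {f g : Fin n → ℕ} → (∀ i → f i ≤ g i) → sum f ≤ sum g
∑-mono-≤ {zero}  f≤g = z≤n
∑-mono-≤ {suc n} f≤g = +-mono-≤ (f≤g zero) (∑-mono-≤ (λ i → f≤g (suc i)))

term≤∑ : ∀ {n} (f : Fin n → ℕ) i → f i ≤ sum f
term≤∑ f zero    = m≤m+n _ _
term≤∑ f (suc i) = ≤-trans (term≤∑ (λ j → f (suc j)) i) (m≤n+m _ _)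

∑-𝟙-≟ : ∀ {n} (v : Fin n) (f : Fin n → ℕ) → ∑[ u < n ] (𝟙 (u Fin.≟ v) * f u) ≡ f v
∑-𝟙-≟ {suc n} zero f = trans (cong₂ _+_ (*-identityˡ (f zero)) (sum-replicate-zero n)) (+-identityʳ (f zero))
∑-𝟙-≟ (suc v) f = ∑-𝟙-≟ v (λ u → f (suc u))

∃-≤-mean : ∀ {n} (f : Fin (suc n) → ℕ) → ∃ λ i → suc n * f i ≤ sum f
∃-≤-mean {zero} f = zero , ≤-refl
∃-≤-mean {suc n} f with ∃-≤-mean (λ i → f (suc i))
... | j , mean≤ with f zero ≤? f (suc j)
...   | yes f₀≤ = zero , +-monoʳ-≤ (f zero) (≤-trans (*-monoʳ-≤ (suc n) f₀≤) mean≤)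
...   | no  f₀≰ = suc j , +-mono-≤ (<⇒≤ (≰⇒> f₀≰)) mean≤

∑-𝟙-lookup-≡0 : ∀ y xs → All (y ≢_) xs → ∑[ i < length xs ] 𝟙 (y ≟ lookup xs i) ≡ 0
∑-𝟙-lookup-≡0 y [] [] = refl
∑-𝟙-lookup-≡0 y (x ∷ xs) (y≢x ∷ y∉xs) = cong₂ _+_ (𝟙-no (y ≟ x) y≢x) (∑-𝟙-lookup-≡0 y xs y∉xs)

∑-𝟙-lookup-≤1 : ∀ y xs → Unique xs → ∑[ i < length xs ] 𝟙 (y ≟ lookup xs i) ≤ 1
∑-𝟙-lookup-≤1 y [] [] = z≤n
∑-𝟙-lookup-≤1 y (x ∷ xs) (x∉xs ∷ xs!) with y ≟ x
... | yes refl = ≤-reflexive (cong₂ _+_ (𝟙-yes (y ≟ y) refl) (∑-𝟙-lookup-≡0 y xs x∉xs))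
... | no  y≢x  = subst (_≤ 1) (cong (_+ _) (sym (𝟙-no (y ≟ x) y≢x))) (∑-𝟙-lookup-≤1 y xs xs!)

mass : ∀ {n} → (Fin n → ℕ) → (Fin n → ℕ) → ℕ → ℕ
mass {n} g C x = ∑[ w < n ] (g w * 𝟙 (C w ≟ x))

∑-mass-≤ : ∀ {n} (g C : Fin n → ℕ) xs → Unique xs → ∑[ i < length xs ] mass g C (lookup xs i) ≤ sum g
∑-mass-≤ {n} g C xs xs! = begin
  ∑[ i < length xs ] ∑[ w < n ] (g w * 𝟙 (C w ≟ lookup xs i))  ≡⟨ ∑-comm (λ i w → g w * 𝟙 (C w ≟ lookup xs i)) ⟩
  ∑[ w < n ] ∑[ i < length xs ] (g w * 𝟙 (C w ≟ lookup xs i))  ≤⟨ ∑-mono-≤ at-most-g ⟩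
  sum g                                                        ∎
  where
  open ≤-Reasoning
  at-most-g : ∀ w → ∑[ i < length xs ] (g w * 𝟙 (C w ≟ lookup xs i)) ≤ g w
  at-most-g w = begin
    ∑[ i < length xs ] (g w * 𝟙 (C w ≟ lookup xs i))  ≡⟨ ∑-scale (g w) (λ i → 𝟙 (C w ≟ lookup xs i)) ⟩
    g w * ∑[ i < length xs ] 𝟙 (C w ≟ lookup xs i)    ≤⟨ *-monoʳ-≤ (g w) (∑-𝟙-lookup-≤1 (C w) xs xs!) ⟩
    g w * 1                                           ≡⟨ *-identityʳ (g w) ⟩
    g w                                               ∎

-- Eliminate index 0, scaling by e = c₀ ∸ a₀₀ (which exceeds the rest of row 0) to stay in ℕ.
module Elimination {m} (a : Fin (suc m) → Fin (suc m) → ℕ) (c : Fin (suc m) → ℕ)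
                   (rows< : ∀ i → ∑[ j < suc m ] a i j < c i) where

  r : ℕ
  r = ∑[ j < m ] a zero (suc j)

  e : ℕ
  e = c zero ∸ a zero zero

  a₀₀+e≡c₀ : a zero zero + e ≡ c zero
  a₀₀+e≡c₀ = m+[n∸m]≡n (≤-trans (m≤m+n _ r) (<⇒≤ (rows< zero)))

  r<e : r < e
  r<e = +-cancelˡ-< (a zero zero) r e (subst (a zero zero + r <_) (sym a₀₀+e≡c₀) (rows< zero))

  instance
    e-nonZero : NonZero e
    e-nonZero = >-nonZero (≤-<-trans z≤n r<e)

  a′ : Fin m → Fin m → ℕ
  a′ i j = e * a (suc i) (suc j) + a (suc i) zero * a zero (suc j)

  c′ : Fin m → ℕ
  c′ i = e * c (suc i)

  reduced-rows< : ∀ i → ∑[ j < m ] a′ i j < c′ i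
  reduced-rows< i = begin-strict
    ∑[ j < m ] a′ i j
      ≡⟨ ∑-distrib-+ (λ j → e * a (suc i) (suc j)) (λ j → a (suc i) zero * a zero (suc j)) ⟩
    ∑[ j < m ] (e * a (suc i) (suc j)) + ∑[ j < m ] (a (suc i) zero * a zero (suc j))
      ≡⟨ cong₂ _+_ (∑-scale e (λ j → a (suc i) (suc j))) (∑-scale (a (suc i) zero) (λ j → a zero (suc j))) ⟩
    e * rest + a (suc i) zero * r      ≤⟨ +-monoʳ-≤ (e * rest) (*-monoʳ-≤ (a (suc i) zero) (<⇒≤ r<e)) ⟩
    e * rest + a (suc i) zero * e      ≡⟨ cong (e * rest +_) (*-comm (a (suc i) zero) e) ⟩
    e * rest + e * a (suc i) zero      ≡⟨ *-distribˡ-+ e rest _ ⟨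
    e * (rest + a (suc i) zero)        ≡⟨ cong (e *_) (+-comm rest _) ⟩
    e * (a (suc i) zero + rest)        <⟨ *-monoʳ-< e (rows< (suc i)) ⟩
    e * c (suc i)                      ∎
    where
    open ≤-Reasoning
    rest : ℕ
    rest = ∑[ j < m ] a (suc i) (suc j)

  -- Scaling the old weights by e², one e more than c′ = e·c accounts for, leaves room for
  -- the new column entries a₀ⱼ < e.
  lift : (Fin m → ℕ) → Fin (suc m) → ℕ
  lift α′ zero    = e * ∑[ i < m ] (α′ i * a (suc i) zero) + 1
  lift α′ (suc i) = e * e * α′ i

  module _ (α′ : Fin m → ℕ) (columns< : ∀ j → ∑[ i < m ] (α′ i * a′ i j) < α′ j * c′ j) where

    ∑-lift : ∀ (b : Fin m → ℕ) → ∑[ i < m ] (lift α′ (suc i) * b i) ≡ e * e * ∑[ i < m ] (α′ i * b i)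
    ∑-lift b = trans (sum-cong-≗ (λ i → *-assoc (e * e) (α′ i) (b i))) (∑-scale (e * e) (λ i → α′ i * b i))

    X : ℕ
    X = ∑[ i < m ] (α′ i * a (suc i) zero)

    lift-column₀< : ∑[ i < suc m ] (lift α′ i * a i zero) < lift α′ zero * c zero
    lift-column₀< = begin-strict
      x₀ * a zero zero + ∑[ i < m ] (lift α′ (suc i) * a (suc i) zero)
                                      ≡⟨ cong (x₀ * a zero zero +_) (∑-lift (λ i → a (suc i) zero)) ⟩
      x₀ * a zero zero + e * e * X    ≡⟨ cong (x₀ * a zero zero +_) (*-assoc e e X) ⟩
      x₀ * a zero zero + e * (e * X)  <⟨ +-monoʳ-< (x₀ * a zero zero) (*-monoʳ-< e (m<m+n (e * X) z<s)) ⟩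
      x₀ * a zero zero + e * x₀       ≡⟨ cong (x₀ * a zero zero +_) (*-comm e x₀) ⟩
      x₀ * a zero zero + x₀ * e       ≡⟨ *-distribˡ-+ x₀ (a zero zero) e ⟨
      x₀ * (a zero zero + e)          ≡⟨ cong (x₀ *_) a₀₀+e≡c₀ ⟩
      x₀ * c zero                     ∎
      where
      open ≤-Reasoning
      x₀ : ℕ
      x₀ = lift α′ zero

    lift-column< : ∀ j → ∑[ i < suc m ] (lift α′ i * a i (suc j)) < lift α′ (suc j) * c (suc j)
    lift-column< j = begin-strict
      (e * X + 1) * b + ∑[ i < m ] (lift α′ (suc i) * a (suc i) (suc j))
                                      ≡⟨ cong ((e * X + 1) * b +_) (∑-lift (λ i → a (suc i) (suc j))) ⟩
      (e * X + 1) * b + e * e * Y     ≡⟨ regroup e X Y b ⟩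
      b + e * (e * Y + X * b)         ≡⟨ cong (λ t → b + e * t) Z≡ ⟨
      b + e * Z                       <⟨ +-monoˡ-< (e * Z) (≤-<-trans (term≤∑ (λ j → a zero (suc j)) j) r<e) ⟩
      e + e * Z                       ≡⟨ *-suc e Z ⟨
      e * suc Z                       ≤⟨ *-monoʳ-≤ e (columns< j) ⟩
      e * (α′ j * (e * c (suc j)))    ≡⟨ reassociate e (α′ j) (c (suc j)) ⟩
      e * e * α′ j * c (suc j)        ∎
      where
      open ≤-Reasoning
      b Y Z : ℕ
      b = a zero (suc j)
      Y = ∑[ i < m ] (α′ i * a (suc i) (suc j))
      Z = ∑[ i < m ] (α′ i * a′ i j)
      regroup : ∀ e X Y b → (e * X + 1) * b + e * e * Y ≡ b + e * (e * Y + X * b)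
      regroup = solve-∀
      reassociate : ∀ e α c → e * (α * (e * c)) ≡ e * e * α * c
      reassociate = solve-∀
      distribute : ∀ α e A B b → α * (e * A + B * b) ≡ e * (α * A) + α * B * b
      distribute = solve-∀
      Z≡ : Z ≡ e * Y + X * b
      Z≡ = begin-equality
        Z  ≡⟨ sum-cong-≗ (λ i → distribute (α′ i) e (a (suc i) (suc j)) (a (suc i) zero) b) ⟩
        ∑[ i < m ] (e * (α′ i * a (suc i) (suc j)) + α′ i * a (suc i) zero * b)
           ≡⟨ ∑-distrib-+ (λ i → e * (α′ i * a (suc i) (suc j))) (λ i → α′ i * a (suc i) zero * b) ⟩
        ∑[ i < m ] (e * (α′ i * a (suc i) (suc j))) + ∑[ i < m ] (α′ i * a (suc i) zero * b)
           ≡⟨ cong₂ _+_ (∑-scale e (λ i → α′ i * a (suc i) (suc j)))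
                        (sym (*-distribʳ-sum b (λ i → α′ i * a (suc i) zero))) ⟩
        e * Y + X * b ∎

    lift-columns< : ∀ j → ∑[ i < suc m ] (lift α′ i * a i j) < lift α′ j * c j
    lift-columns< zero    = lift-column₀<
    lift-columns< (suc j) = lift-column< j

dominated-weights : ∀ n (a : Fin n → Fin n → ℕ) (c : Fin n → ℕ) → (∀ i → ∑[ j < n ] a i j < c i) →
                    ∃ λ (α : Fin n → ℕ) → ∀ j → ∑[ i < n ] (α i * a i j) < α j * c j
dominated-weights zero    a c rows< = (λ ()) , (λ ())
dominated-weights (suc m) a c rows< =
  let α′ , columns< = dominated-weights m a′ c′ reduced-rows< in lift α′ , lift-columns< α′ columns<
  where open Elimination a c rows<

length-filter-tabulate : ∀ {a p n} {A : Set a} {P : Pred A p} (P? : Decidable P) (f : Fin n → A) →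
                         length (filter P? (tabulate f)) ≡ ∑[ i < n ] 𝟙 (P? (f i))
length-filter-tabulate {n = zero}  P? f = refl
length-filter-tabulate {n = suc n} P? f with does (P? (f zero))
... | true  = cong suc (length-filter-tabulate P? (f ∘ suc))
... | false = length-filter-tabulate P? (f ∘ suc)

length-filter-filter-tabulate :
  ∀ {a p q n} {A : Set a} {P : Pred A p} {Q : Pred A q} (P? : Decidable P) (Q? : Decidable Q) (f : Fin n → A) →
  length (filter Q? (filter P? (tabulate f))) ≡ ∑[ i < n ] (𝟙 (P? (f i)) * 𝟙 (Q? (f i)))
length-filter-filter-tabulate {n = zero}  P? Q? f = refl
length-filter-filter-tabulate {n = suc n} P? Q? f with does (P? (f zero))
... | false = length-filter-filter-tabulate P? Q? (f ∘ suc)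
... | true with does (Q? (f zero))
...   | true  = cong suc (length-filter-filter-tabulate P? Q? (f ∘ suc))
...   | false = length-filter-filter-tabulate P? Q? (f ∘ suc)

Colouring : Digraph → Set
Colouring G = Fin (n G) → ℕ

edge : (G : Digraph) → Fin (n G) → Fin (n G) → ℕ
edge G u w = 𝟙 (E G u w Bool.≟ true)

edge-loop : (G : Digraph) (v : Fin (n G)) → edge G v v ≡ 0
edge-loop G v rewrite loopless G v = refl

outdeg≡∑edge : (G : Digraph) (v : Fin (n G)) → outdeg G v ≡ ∑[ w < n G ] edge G v w
outdeg≡∑edge G v = length-filter-tabulate (λ w → E G v w Bool.≟ true) id

sameColOut≡mass : (G : Digraph) (C : Colouring G) (v : Fin (n G)) → sameColOut G C v ≡ mass (edge G v) C (C v)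
sameColOut≡mass G C v = length-filter-filter-tabulate (λ w → E G v w Bool.≟ true) (λ w → C w ≟ C v) id

recolour : ∀ {n} → (Fin n → ℕ) → Fin n → ℕ → Fin n → ℕ
recolour C v x = updateAt C v (const x)

module Potential (G : Digraph) (α : Fin (n G) → ℕ) where

  conflict : Colouring G → Fin (n G) → Fin (n G) → ℕ
  conflict C u w = α u * (edge G u w * 𝟙 (C w ≟ C u))

  Φ : Colouring G → ℕ
  Φ C = ∑[ u < n G ] ∑[ w < n G ] conflict C u w

  Φ-cong : ∀ {C D} → C ≗ D → Φ C ≡ Φ D
  Φ-cong C≗D = sum-cong-≗ λ u → sum-cong-≗ λ w →
    cong₂ (λ y x → α u * (edge G u w * 𝟙 (y ≟ x))) (C≗D w) (C≗D u)

  -- The part of Φ carried by the edges at v once v is coloured x.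
  cost : Colouring G → Fin (n G) → ℕ → ℕ
  cost C v x = α v * mass (edge G v) C x + mass (λ u → α u * edge G u v) C x

  module _ (C : Colouring G) (v : Fin (n G)) where

    away : Fin (n G) → Fin (n G) → ℕ
    away u w = 𝟙 (¬? (u Fin.≟ v)) * 𝟙 (¬? (w Fin.≟ v)) * conflict C u w

    out-term in-term : ℕ → Fin (n G) → Fin (n G) → ℕ
    out-term x u w = 𝟙 (u Fin.≟ v) * (α u * (edge G u w * 𝟙 (C w ≟ x)))
    in-term  x u w = 𝟙 (w Fin.≟ v) * (α u * edge G u w * 𝟙 (C u ≟ x))

    conflict-recolour : ∀ x u w → conflict (recolour C v x) u w ≡ away u w + (out-term x u w + in-term x u w)
    conflict-recolour x u w with u Fin.≟ v | w Fin.≟ v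
    ... | yes refl | yes refl rewrite edge-loop G v | *-zeroʳ (α v) = refl
    ... | yes refl | no  w≢v  rewrite updateAt-updates v {const x} C | updateAt-minimal w v {const x} C w≢v =
      sym (trans (+-identityʳ _) (+-identityʳ _))
    ... | no  u≢v  | yes refl rewrite updateAt-updates v {const x} C | updateAt-minimal u v {const x} C u≢v =
      trans (sym (*-assoc (α u) (edge G u v) _))
            (trans (cong (α u * edge G u v *_) (𝟙-≟-sym x (C u))) (sym (+-identityʳ _)))
    ... | no  u≢v  | no  w≢v  rewrite updateAt-minimal u v {const x} C u≢v | updateAt-minimal w v {const x} C w≢v =
      sym (trans (+-identityʳ _) (+-identityʳ _))

    Φ-away : ℕ
    Φ-away = ∑[ u < n G ] ∑[ w < n G ] away u w

    ∑∑-out-term : ∀ x → ∑[ u < n G ] ∑[ w < n G ] out-term x u w ≡ α v * mass (edge G v) C x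
    ∑∑-out-term x = begin
      ∑[ u < n G ] ∑[ w < n G ] out-term x u w
        ≡⟨ sum-cong-≗ (λ u → ∑-scale (𝟙 (u Fin.≟ v)) (λ w → α u * (edge G u w * 𝟙 (C w ≟ x)))) ⟩
      ∑[ u < n G ] (𝟙 (u Fin.≟ v) * ∑[ w < n G ] (α u * (edge G u w * 𝟙 (C w ≟ x))))
        ≡⟨ ∑-𝟙-≟ v (λ u → ∑[ w < n G ] (α u * (edge G u w * 𝟙 (C w ≟ x)))) ⟩
      ∑[ w < n G ] (α v * (edge G v w * 𝟙 (C w ≟ x)))
        ≡⟨ ∑-scale (α v) (λ w → edge G v w * 𝟙 (C w ≟ x)) ⟩
      α v * mass (edge G v) C x ∎
      where open ≡-Reasoning

    ∑∑-in-term : ∀ x → ∑[ u < n G ] ∑[ w < n G ] in-term x u w ≡ mass (λ u → α u * edge G u v) C x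
    ∑∑-in-term x = sum-cong-≗ (λ u → ∑-𝟙-≟ v (λ w → α u * edge G u w * 𝟙 (C u ≟ x)))

    Φ-recolour : ∀ x → Φ (recolour C v x) ≡ Φ-away + cost C v x
    Φ-recolour x = begin
      Φ (recolour C v x)
        ≡⟨ sum-cong-≗ (λ u → sum-cong-≗ (conflict-recolour x u)) ⟩
      ∑[ u < n G ] ∑[ w < n G ] (away u w + (out-term x u w + in-term x u w))
        ≡⟨ ∑∑-distrib-+ away (λ u w → out-term x u w + in-term x u w) ⟩
      Φ-away + ∑[ u < n G ] ∑[ w < n G ] (out-term x u w + in-term x u w)
        ≡⟨ cong (Φ-away +_) (∑∑-distrib-+ (out-term x) (in-term x)) ⟩
      Φ-away + (∑[ u < n G ] ∑[ w < n G ] out-term x u w + ∑[ u < n G ] ∑[ w < n G ] in-term x u w)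
        ≡⟨ cong (Φ-away +_) (cong₂ _+_ (∑∑-out-term x) (∑∑-in-term x)) ⟩
      Φ-away + cost C v x ∎
      where open ≡-Reasoning

    Φ-recolour-< : ∀ x → cost C v x < cost C v (C v) → Φ (recolour C v x) < Φ C
    Φ-recolour-< x cost< = begin-strict
      Φ (recolour C v x)           ≡⟨ Φ-recolour x ⟩
      Φ-away + cost C v x          <⟨ +-monoʳ-< Φ-away cost< ⟩
      Φ-away + cost C v (C v)      ≡⟨ Φ-recolour (C v) ⟨
      Φ (recolour C v (C v))       ≡⟨ Φ-cong (updateAt-id-local v C refl) ⟩
      Φ C                          ∎
      where open ≤-Reasoning

    ∑-cost-≤ : ∀ xs → Unique xs →
               ∑[ i < length xs ] cost C v (lookup xs i) ≤
               α v * ∑[ w < n G ] edge G v w + ∑[ u < n G ] (α u * edge G u v)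
    ∑-cost-≤ xs xs! = begin
      ∑[ i < k ] cost C v (lookup xs i)
        ≡⟨ ∑-distrib-+ (λ i → α v * out (lookup xs i)) (λ i → inn (lookup xs i)) ⟩
      ∑[ i < k ] (α v * out (lookup xs i)) + ∑[ i < k ] inn (lookup xs i)
        ≡⟨ cong (_+ ∑[ i < k ] inn (lookup xs i)) (∑-scale (α v) (λ i → out (lookup xs i))) ⟩
      α v * ∑[ i < k ] out (lookup xs i) + ∑[ i < k ] inn (lookup xs i)
        ≤⟨ +-mono-≤ (*-monoʳ-≤ (α v) (∑-mass-≤ (edge G v) C xs xs!))
                    (∑-mass-≤ (λ u → α u * edge G u v) C xs xs!) ⟩
      α v * ∑[ w < n G ] edge G v w + ∑[ u < n G ] (α u * edge G u v) ∎
      where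
      open ≤-Reasoning
      k = length xs
      out inn : ℕ → ℕ
      out = mass (edge G v) C
      inn = mass (λ u → α u * edge G u v) C

recolour-isLColouring : (G : Digraph) (L : ListAssignment G) (C : Colouring G) (v : Fin (n G)) {x : ℕ} →
                        L v x → IsLColouring G L C → IsLColouring G L (recolour C v x)
recolour-isLColouring G L C v {x} Lx C∈L u with u Fin.≟ v
... | yes refl = subst (L u) (sym (updateAt-updates u {const x} C)) Lx
... | no  u≢v  = subst (L u) (sym (updateAt-minimal u v {const x} C u≢v)) (C∈L u)

AtLeast⇒∃ : ∀ {k S} → 0 < k → AtLeast k S → ∃ S
AtLeast⇒∃ 0<k ([] , refl , _) = contradiction 0<k (λ ())
AtLeast⇒∃ _ (x ∷ _ , _ , _ , Sx ∷ _) = x , Sx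

module Improvement (G : Digraph) (α : Fin (n G) → ℕ)
                   (α-dominates : ∀ v → ∑[ u < n G ] (α u * edge G u v) < α v * suc (outdeg G v)) where

  open Potential G α public

  cheaper-colour : ∀ (C : Colouring G) v xs → Unique xs → 2 * outdeg G v < length xs * sameColOut G C v →
                   ∃ λ i → cost C v (lookup xs i) < cost C v (C v)
  cheaper-colour C v [] _ bad = contradiction bad (λ ())
  cheaper-colour C v xs@(_ ∷ _) xs! bad with ∃-≤-mean (λ i → cost C v (lookup xs i))
  ... | i , mean≤ = i , *-cancelˡ-< k _ _ (begin-strict
    k * cost C v (lookup xs i)             ≤⟨ mean≤ ⟩
    ∑[ j < k ] cost C v (lookup xs j)      ≤⟨ ∑-cost-≤ C v xs xs! ⟩
    α v * ∑[ w < n G ] edge G v w + In     ≡⟨ cong (λ t → α v * t + In) (outdeg≡∑edge G v) ⟨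
    α v * d + In                           <⟨ +-monoʳ-< (α v * d) (α-dominates v) ⟩
    α v * d + α v * suc d                  ≡⟨ *-distribˡ-+ (α v) d (suc d) ⟨
    α v * (d + suc d)                      ≡⟨ cong (α v *_) (m+1+m≡1+2m d) ⟩
    α v * suc (2 * d)                      ≤⟨ *-monoʳ-≤ (α v) bad ⟩
    α v * (k * sameColOut G C v)           ≡⟨ cong (λ t → α v * (k * t)) (sameColOut≡mass G C v) ⟩
    α v * (k * mass (edge G v) C (C v))    ≡⟨ m*[n*o]≡n*[m*o] (α v) k _ ⟩
    k * (α v * mass (edge G v) C (C v))    ≤⟨ *-monoʳ-≤ k (m≤m+n _ _) ⟩
    k * cost C v (C v)                     ∎)
    where
    open ≤-Reasoning
    k d In : ℕ
    k = length xs
    d = outdeg G v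
    In = ∑[ u < n G ] (α u * edge G u v)
    m+1+m≡1+2m : ∀ d → d + suc d ≡ suc (2 * d)
    m+1+m≡1+2m = solve-∀
    m*[n*o]≡n*[m*o] : ∀ x y z → x * (y * z) ≡ y * (x * z)
    m*[n*o]≡n*[m*o] = solve-∀

  module _ {k} (L : ListAssignment G) (L≥k : ∀ v → AtLeast k (L v)) where

    improve : ∀ C → IsLColouring G L C → ∀ v → ¬ (k * sameColOut G C v ≤ 2 * outdeg G v) →
              ∃ λ C′ → IsLColouring G L C′ × Φ C′ < Φ C
    improve C C∈L v ¬bound with L≥k v
    ... | xs , |xs|≡k , xs! , xs⊆Lv =
      let i , cheaper = cheaper-colour C v xs xs! violated in
      recolour C v (lookup xs i) ,
      recolour-isLColouring G L C v (All.lookup xs⊆Lv (∈-lookup i)) C∈L ,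
      Φ-recolour-< C v (lookup xs i) cheaper
      where
      violated : 2 * outdeg G v < length xs * sameColOut G C v
      violated = subst (λ k → 2 * outdeg G v < k * sameColOut G C v) (sym |xs|≡k) (≰⇒> ¬bound)

    majority-colouring : ∀ C → IsLColouring G L C → Acc _<_ (Φ C) →
                         Σ (Colouring G) λ C → IsLColouring G L C × IsMajority 2 k G C
    majority-colouring C C∈L (acc smaller) with Fin.all? (λ v → k * sameColOut G C v ≤? 2 * outdeg G v)
    ... | yes majority = C , C∈L , majority
    ... | no ¬majority with Fin.¬∀⟶∃¬ (n G) _ (λ v → k * sameColOut G C v ≤? 2 * outdeg G v) ¬majority
    ...   | v , bad with improve C C∈L v bad
    ...     | C′ , C′∈L , Φ< = majority-colouring C′ C′∈L (smaller Φ<)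

theorem1 : (k : ℕ) → 2 ≤ k → (G : Digraph) → MajorityChoosable 2 k k G
theorem1 k 2≤k G L L≥k = majority-colouring L L≥k C₀ C₀∈L (<-wellFounded (Φ C₀))
  where
  weights : ∃ λ α → ∀ v → ∑[ u < n G ] (α u * edge G u v) < α v * suc (outdeg G v)
  weights = dominated-weights (n G) (edge G) (λ v → suc (outdeg G v))
                              (λ v → s≤s (≤-reflexive (sym (outdeg≡∑edge G v))))
  open Improvement G (proj₁ weights) (proj₂ weights)
  initial : ∀ v → ∃ (L v)
  initial v = AtLeast⇒∃ (≤-trans (s≤s z≤n) 2≤k) (L≥k v)
  C₀ : Colouring G
  C₀ v = proj₁ (initial v)
  C₀∈L : IsLColouring G L C₀
  C₀∈L v = proj₂ (initial v)
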